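{- Let $G$ be a graph on vertex set $C_1\cup C_2$ with $C_1=\{v_{1,1},\dots,v_{1,q}\}$, $C_2=\{v_{2,1},\dots,v_{2,q}\}$, and let $G'$ be a graph on a disjoint vertex set $C_1'\cup C_2'$ with $C_1'=\{v_{1,q+1},\dots,v_{1,q+r}\}$, $C_2'=\{v_{2,q+1},\dots,v_{2,q+r}\}$. Suppose $G$ is $Q$-cospectral to its partial transpose $G^\tau$ and $G'$ is isomorphic to its partial transpose $(G')^\tau$. Let $G_1=G\cup G'$ be the disjoint union, regarded as a graph with the two clusters $C_1\cup C_1'$ and $C_2\cup C_2'$ (each of size $q+r$). Then $G_1$ is $Q$-cospectral to its partial transpose $G_1^\tau$.
   Context: Partial transpose: for a simple graph $H$ whose vertex set is partitioned into two clusters $\{v_{1,1},\dots,v_{1,n}\}$ and $\{v_{2,1},\dots,v_{2,n}\}$, $H^\tau$ is the graph on the same vertex set obtained from $H$ by removing every existing edge $(v_{1,a},v_{2,b})$ with $a\neq b$ and adding the edge $(v_{1,b},v_{2,a})$ instead; all edges inside each cluster and of the form $(v_{1,k},v_{2,k})$ are kept. The signless Laplacian of a graph $H$ is $Q(H)=D(H)+A(H)$ (degree matrix plus adjacency matrix); two graphs are $Q$-cospectral if their signless Laplacians have the same multiset of eigenvalues. -}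

module Defs where

open import Data.Nat using (ℕ; zero; suc; _+_)
open import Data.Fin using (Fin; zero; suc; splitAt; punchIn; toℕ)
import Data.Fin.Properties as FinP
open import Data.Sum using (_⊎_; inj₁; inj₂)
import Data.Sum as Sum
import Data.Sum.Properties as SumP
open import Data.Bool using (Bool; true; false; if_then_else_)
open import Data.Integer using (ℤ; +_; 0ℤ; 1ℤ; -_) renaming (_+_ to _+ℤ_; _*_ to _*ℤ_)
open import Data.List using (List; []; _∷_)
open import Data.Product using (Σ)
open import Relation.Nullary.Decidable using (⌊_⌋)
open import Relation.Binary.PropositionalEquality using (_≡_)
open import Function.Bundles using (_↔_; Inverse)

-- Vertices: a graph with two clusters of size n.
-- inj₁ a is v_{1,a}, inj₂ b is v_{2,b}.

V : ℕ → Set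
V n = Fin n ⊎ Fin n

_≟V_ : ∀ {n} (x y : V n) → _
_≟V_ = SumP.≡-dec FinP._≟_ FinP._≟_

Adj : ℕ → Set
Adj n = V n → V n → Bool

record IsSimple {n : ℕ} (A : Adj n) : Set where
  field
    sym    : ∀ x y → A x y ≡ A y x
    irrefl : ∀ x → A x x ≡ false

partialTranspose : ∀ {n} → Adj n → Adj n
partialTranspose A (inj₁ a) (inj₁ b) = A (inj₁ a) (inj₁ b)
partialTranspose A (inj₂ a) (inj₂ b) = A (inj₂ a) (inj₂ b)
partialTranspose A (inj₁ a) (inj₂ b) = A (inj₁ b) (inj₂ a)
partialTranspose A (inj₂ b) (inj₁ a) = A (inj₂ a) (inj₁ b)

Isomorphic : ∀ {n} → Adj n → Adj n → Set
Isomorphic {n} A B =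
  Σ (V n ↔ V n) λ σ → ∀ x y → B (Inverse.to σ x) (Inverse.to σ y) ≡ A x y

-- Disjoint union with clusters C1 ∪ C1' and C2 ∪ C2':
-- index i < q belongs to G, index q + j to G' (i.e. v_{k,q+1+j}).

splitV : ∀ q r → V (q + r) → V q ⊎ V r
splitV q r (inj₁ i) = Sum.map inj₁ inj₁ (splitAt q i)
splitV q r (inj₂ i) = Sum.map inj₂ inj₂ (splitAt q i)

unionAdj' : ∀ {q r} → Adj q → Adj r → V q ⊎ V r → V q ⊎ V r → Bool
unionAdj' G G' (inj₁ x) (inj₁ y) = G x y
unionAdj' G G' (inj₂ x) (inj₂ y) = G' x y
unionAdj' G G' (inj₁ x) (inj₂ y) = false
unionAdj' G G' (inj₂ x) (inj₁ y) = false

disjointUnion : ∀ {q r} → Adj q → Adj r → Adj (q + r)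
disjointUnion {q} {r} G G' x y = unionAdj' G G' (splitV q r x) (splitV q r y)

-- Integer polynomials (coefficient lists, lowest degree first).

Poly : Set
Poly = List ℤ

coeff : Poly → ℕ → ℤ
coeff []      k       = 0ℤ
coeff (a ∷ p) zero    = a
coeff (a ∷ p) (suc k) = coeff p k

_+ₚ_ : Poly → Poly → Poly
[]      +ₚ q       = q
(a ∷ p) +ₚ []      = a ∷ p
(a ∷ p) +ₚ (b ∷ q) = (a +ℤ b) ∷ (p +ₚ q)

scaleₚ : ℤ → Poly → Poly
scaleₚ c []      = []
scaleₚ c (a ∷ p) = (c *ℤ a) ∷ scaleₚ c p

negₚ : Poly → Poly
negₚ = scaleₚ (- 1ℤ)

_*ₚ_ : Poly → Poly → Poly
[]      *ₚ q = []
(a ∷ p) *ₚ q = scaleₚ a q +ₚ (0ℤ ∷ (p *ₚ q))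

sumₚ : ∀ k → (Fin k → Poly) → Poly
sumₚ zero    f = []
sumₚ (suc k) f = f zero +ₚ sumₚ k (λ i → f (suc i))

altₚ : ℕ → Poly → Poly
altₚ zero    p = p
altₚ (suc k) p = negₚ (altₚ k p)

det : ∀ m → (Fin m → Fin m → Poly) → Poly
det zero    M = 1ℤ ∷ []
det (suc m) M = sumₚ (suc m) λ j →
  altₚ (toℕ j) (M zero j *ₚ det m (λ a b → M (suc a) (punchIn j b)))

vertex : ∀ n → Fin (n + n) → V n
vertex n = splitAt n

b2z : Bool → ℤ
b2z true  = 1ℤ
b2z false = 0ℤ

sumℤ : ∀ k → (Fin k → ℤ) → ℤ
sumℤ zero    f = 0ℤ
sumℤ (suc k) f = f zero +ℤ sumℤ k (λ i → f (suc i))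

degree : ∀ {n} → Adj n → V n → ℤ
degree {n} A x = sumℤ (n + n) λ i → b2z (A x (vertex n i))

signlessLaplacian : ∀ {n} → Adj n → V n → V n → ℤ
signlessLaplacian A x y =
  (if ⌊ x ≟V y ⌋ then degree A x else 0ℤ) +ℤ b2z (A x y)

charPolyQ : ∀ {n} → Adj n → Poly
charPolyQ {n} A = det (n + n) λ i j →
  let x = vertex n i ; y = vertex n j in
  (if ⌊ x ≟V y ⌋ then 0ℤ ∷ 1ℤ ∷ [] else [])
    +ₚ ((- signlessLaplacian A x y) ∷ [])

-- Q-cospectral: signless Laplacians have the same eigenvalue multiset,
-- i.e. the same characteristic polynomial.
QCospectral : ∀ {n} → Adj n → Adj n → Set
QCospectral A B = ∀ k → coeff (charPolyQ A) k ≡ coeff (charPolyQ B) k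

{-# OPTIONS --safe #-}

-- Write χ(H) = det(tI − Q(H)). Listing the vertices of G ∪ G′ component by component makes
-- tI − Q(G ∪ G′) block diagonal with blocks tI − Q(G) and tI − Q(G′), and relisting vertices
-- permutes rows and columns simultaneously, which does not change a determinant. Hence χ is
-- multiplicative on disjoint unions and invariant under isomorphism. Partial transposition
-- acts on the two components separately, so
-- χ((G ∪ G′)^τ) = χ(G^τ) χ(G′^τ) = χ(G) χ(G′) = χ(G ∪ G′).
-- The determinant is a Laplace expansion along the first row, so invariance under a
-- simultaneous permutation is reduced, via transpositions, to adjacent column swaps, whose
-- effect on the expansion can be tracked directly.

module Submission where

open import Data.Nat using (ℕ; zero; suc; s≤s; _<_; _∸_)
import Data.Nat as ℕ
import Data.Nat.Properties as ℕₚ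
open import Data.Fin using (Fin; zero; suc; toℕ; inject₁; punchIn; splitAt; _↑ˡ_; _↑ʳ_)
open import Data.Fin.Properties
  using (_≟_; suc-injective; toℕ-injective; toℕ-inject₁; toℕ-↑ˡ; splitAt-↑ˡ; splitAt-↑ʳ)
open import Data.Fin.Permutation.Components using (transpose; transpose-inverse)
open import Data.Sum as Sum using (_⊎_; inj₁; inj₂)
open import Data.Product using (_,_)
open import Data.List using ([]; _∷_)
open import Data.Vec.Functional using (Vector)
open import Data.Empty using (⊥-elim)
open import Function using (_∘_; id; _↔_; Inverse)
open import Function.Construct.Composition using (_↔-∘_)
open import Function.Construct.Symmetry using (↔-sym)
open import Algebra.Bundles using (CommutativeMonoid; CommutativeRing)
open import Relation.Nullary using (Dec; yes; no)
open import Relation.Binary.PropositionalEquality as ≡ using (_≡_; _≢_)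

module FiniteSum {c ℓ} (M : CommutativeMonoid c ℓ) where

  open import Data.Nat using (_+_)
  open CommutativeMonoid M
  open import Algebra.Properties.CommutativeMonoid.Sum M using (sum; sum-permute; sum-cong-≗)

  sum-splitAt : ∀ m n (f : Vector Carrier (m + n)) → sum f ≈ sum (f ∘ (_↑ˡ n)) ∙ sum (f ∘ (m ↑ʳ_))
  sum-splitAt zero    n f = sym (identityˡ _)
  sum-splitAt (suc m) n f = trans (∙-congˡ (sum-splitAt m n (f ∘ suc))) (sym (assoc _ _ _))

  sum-enumeration-invariant : ∀ {m n} {X : Set} (e : Fin m ↔ X) (e′ : Fin n ↔ X) (f : X → Carrier) →
    sum (f ∘ Inverse.to e) ≈ sum (f ∘ Inverse.to e′)
  sum-enumeration-invariant e e′ f = sym (trans (sum-permute (f ∘ Inverse.to e′) (↔-sym e′ ↔-∘ e))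
    (reflexive (sum-cong-≗ λ i → ≡.cong f (Inverse.strictlyInverseˡ e′ (Inverse.to e i)))))

module AdjacentSwap where

  open ≡ using (refl; cong)

  adjacentSwap : ∀ {m} → Fin m → Fin (suc m) → Fin (suc m)
  adjacentSwap zero    zero          = suc zero
  adjacentSwap zero    (suc zero)    = zero
  adjacentSwap zero    (suc (suc k)) = suc (suc k)
  adjacentSwap (suc c) zero          = zero
  adjacentSwap (suc c) (suc k)       = suc (adjacentSwap c k)

  adjacentSwap-inject₁ : ∀ {m} (c : Fin m) → adjacentSwap c (inject₁ c) ≡ suc c
  adjacentSwap-inject₁ zero    = refl
  adjacentSwap-inject₁ (suc c) = cong suc (adjacentSwap-inject₁ c)

  adjacentSwap-suc : ∀ {m} (c : Fin m) → adjacentSwap c (suc c) ≡ inject₁ c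
  adjacentSwap-suc zero    = refl
  adjacentSwap-suc (suc c) = cong suc (adjacentSwap-suc c)

  adjacentSwap-other : ∀ {m} (c : Fin m) {k} → k ≢ inject₁ c → k ≢ suc c → adjacentSwap c k ≡ k
  adjacentSwap-other zero    {zero}        k≢c _     = ⊥-elim (k≢c refl)
  adjacentSwap-other zero    {suc zero}    _   k≢c+1 = ⊥-elim (k≢c+1 refl)
  adjacentSwap-other zero    {suc (suc k)} _   _     = refl
  adjacentSwap-other (suc c) {zero}        _   _     = refl
  adjacentSwap-other (suc c) {suc k}       k≢c k≢c+1 =
    cong suc (adjacentSwap-other c (k≢c ∘ cong suc) (k≢c+1 ∘ cong suc))

  adjacentSwap-punchIn-inject₁ : ∀ {m} (c : Fin m) b →
    adjacentSwap c (punchIn (inject₁ c) b) ≡ punchIn (suc c) b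
  adjacentSwap-punchIn-inject₁ zero    zero    = refl
  adjacentSwap-punchIn-inject₁ zero    (suc b) = refl
  adjacentSwap-punchIn-inject₁ (suc c) zero    = refl
  adjacentSwap-punchIn-inject₁ (suc c) (suc b) = cong suc (adjacentSwap-punchIn-inject₁ c b)

  adjacentSwap-punchIn-suc : ∀ {m} (c : Fin m) b →
    adjacentSwap c (punchIn (suc c) b) ≡ punchIn (inject₁ c) b
  adjacentSwap-punchIn-suc zero    zero    = refl
  adjacentSwap-punchIn-suc zero    (suc b) = refl
  adjacentSwap-punchIn-suc (suc c) zero    = refl
  adjacentSwap-punchIn-suc (suc c) (suc b) = cong suc (adjacentSwap-punchIn-suc c b)

  data AdjacentSwapView {m} (c : Fin (suc m)) : Fin (suc (suc m)) → Set where
    lower : AdjacentSwapView c (inject₁ c)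
    upper : AdjacentSwapView c (suc c)
    apart : ∀ {j} (c′ : Fin m) → adjacentSwap c j ≡ j →
            (∀ b → adjacentSwap c (punchIn j b) ≡ punchIn j (adjacentSwap c′ b)) →
            AdjacentSwapView c j

  adjacentSwapView : ∀ {m} (c : Fin (suc m)) j → AdjacentSwapView c j
  adjacentSwapView zero            zero          = lower
  adjacentSwapView zero            (suc zero)    = upper
  adjacentSwapView {suc m} zero    (suc (suc j)) = apart zero refl commute
    where
    commute : ∀ b → adjacentSwap zero (punchIn (suc (suc j)) b) ≡ punchIn (suc (suc j)) (adjacentSwap zero b)
    commute zero          = refl
    commute (suc zero)    = refl
    commute (suc (suc b)) = refl
  adjacentSwapView (suc c)         zero          = apart c refl λ _ → refl
  adjacentSwapView {suc m} (suc c) (suc j) with adjacentSwapView c j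
  ... | lower = lower
  ... | upper = upper
  ... | apart c′ fixed commutes = apart (suc c′) (cong suc fixed) commute
    where
    commute : ∀ b → adjacentSwap (suc c) (punchIn (suc j) b) ≡ punchIn (suc j) (adjacentSwap (suc c′) b)
    commute zero    = refl
    commute (suc b) = cong suc (commutes b)

module Transposition where

  open AdjacentSwap
  open import Relation.Nullary.Decidable using (dec-true; dec-false)
  open ≡ using (refl; sym; trans; cong)
  open ≡.≡-Reasoning

  transpose-matchˡ : ∀ {n} (i j : Fin n) → transpose i j i ≡ j
  transpose-matchˡ i j rewrite dec-true (i ≟ i) refl = refl

  transpose-matchʳ : ∀ {n} (i j : Fin n) → transpose i j j ≡ i
  transpose-matchʳ i j with j ≟ i
  ... | yes j≡i = j≡i
  ... | no  _   rewrite dec-true (j ≟ j) refl = refl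

  transpose-other : ∀ {n} {i j k : Fin n} → k ≢ i → k ≢ j → transpose i j k ≡ k
  transpose-other {i = i} {j} {k} k≢i k≢j rewrite dec-false (k ≟ i) k≢i | dec-false (k ≟ j) k≢j = refl

  transpose-same : ∀ {n} (i k : Fin n) → transpose i i k ≡ k
  transpose-same i k = byCases (k ≟ i)
    where
    byCases : Dec (k ≡ i) → transpose i i k ≡ k
    byCases (yes refl) = transpose-matchˡ i i
    byCases (no  k≢i)  = transpose-other k≢i k≢i

  inject₁≢suc : ∀ {m} (c : Fin m) → inject₁ c ≢ suc c
  inject₁≢suc (suc c) eq = inject₁≢suc c (suc-injective eq)

  transpose-adjacent : ∀ {m} (c : Fin m) k → transpose (inject₁ c) (suc c) k ≡ adjacentSwap c k
  transpose-adjacent c k = byCases (k ≟ inject₁ c) (k ≟ suc c)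
    where
    byCases : Dec (k ≡ inject₁ c) → Dec (k ≡ suc c) → transpose (inject₁ c) (suc c) k ≡ adjacentSwap c k
    byCases (yes refl) _          = trans (transpose-matchˡ (inject₁ c) (suc c)) (sym (adjacentSwap-inject₁ c))
    byCases (no _)     (yes refl) = trans (transpose-matchʳ (inject₁ c) (suc c)) (sym (adjacentSwap-suc c))
    byCases (no k≢c)   (no k≢c+1) = trans (transpose-other k≢c k≢c+1) (sym (adjacentSwap-other c k≢c k≢c+1))

  transpose-suc-conjugate : ∀ {m} {a : Fin (suc m)} {c : Fin m} → toℕ a < toℕ c →
    ∀ k → transpose a (suc c) k ≡ adjacentSwap c (transpose a (inject₁ c) (adjacentSwap c k))
  transpose-suc-conjugate {a = a} {c} a<c k = byCases (k ≟ a) (k ≟ suc c) (k ≟ inject₁ c)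
    where
    s = adjacentSwap c
    τ = transpose a (inject₁ c)
    a≢c : a ≢ inject₁ c
    a≢c a≡c = ℕₚ.<⇒≢ a<c (trans (cong toℕ a≡c) (toℕ-inject₁ c))
    a≢c+1 : a ≢ suc c
    a≢c+1 a≡c+1 = ℕₚ.<⇒≢ (ℕₚ.<-trans a<c (ℕₚ.n<1+n (toℕ c))) (cong toℕ a≡c+1)
    byCases : Dec (k ≡ a) → Dec (k ≡ suc c) → Dec (k ≡ inject₁ c) → transpose a (suc c) k ≡ s (τ (s k))
    byCases (yes refl) _ _ = begin
      transpose k (suc c) k  ≡⟨ transpose-matchˡ k (suc c) ⟩
      suc c                  ≡⟨ adjacentSwap-inject₁ c ⟨
      s (inject₁ c)          ≡⟨ cong s (transpose-matchˡ k (inject₁ c)) ⟨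
      s (τ k)                ≡⟨ cong (s ∘ τ) (adjacentSwap-other c a≢c a≢c+1) ⟨
      s (τ (s k))            ∎
    byCases (no _) (yes refl) _ = begin
      transpose a (suc c) (suc c)  ≡⟨ transpose-matchʳ a (suc c) ⟩
      a                            ≡⟨ adjacentSwap-other c a≢c a≢c+1 ⟨
      s a                          ≡⟨ cong s (transpose-matchʳ a (inject₁ c)) ⟨
      s (τ (inject₁ c))            ≡⟨ cong (s ∘ τ) (adjacentSwap-suc c) ⟨
      s (τ (s (suc c)))            ∎
    byCases (no k≢a) (no k≢c+1) (yes refl) = begin
      transpose a (suc c) (inject₁ c)  ≡⟨ transpose-other k≢a k≢c+1 ⟩
      inject₁ c                        ≡⟨ adjacentSwap-suc c ⟨
      s (suc c)                        ≡⟨ cong s (transpose-other (a≢c+1 ∘ sym) (inject₁≢suc c ∘ sym)) ⟨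
      s (τ (suc c))                    ≡⟨ cong (s ∘ τ) (adjacentSwap-inject₁ c) ⟨
      s (τ (s (inject₁ c)))            ∎
    byCases (no k≢a) (no k≢c+1) (no k≢c) = begin
      transpose a (suc c) k  ≡⟨ transpose-other k≢a k≢c+1 ⟩
      k                      ≡⟨ adjacentSwap-other c k≢c k≢c+1 ⟨
      s k                    ≡⟨ cong s (transpose-other k≢a k≢c) ⟨
      s (τ k)                ≡⟨ cong (s ∘ τ) (adjacentSwap-other c k≢c k≢c+1) ⟨
      s (τ (s k))            ∎

splitAt-punchIn-↑ˡ : ∀ m k (j : Fin (suc m)) (b : Fin (m ℕ.+ k)) →
  splitAt (suc m) (punchIn (j ↑ˡ k) b) ≡ Sum.map (punchIn j) id (splitAt m b)
splitAt-punchIn-↑ˡ m       k zero    b       = ≡.refl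
splitAt-punchIn-↑ˡ (suc m) k (suc j) zero    = ≡.refl
splitAt-punchIn-↑ˡ (suc m) k (suc j) (suc b) rewrite splitAt-punchIn-↑ˡ m k j b with splitAt m b
... | inj₁ _ = ≡.refl
... | inj₂ _ = ≡.refl

module Determinant {c ℓ} (R : CommutativeRing c ℓ) where

  open import Data.Fin.Permutation using (Permutation; _⟨$⟩ʳ_; ↔⇒≡)
  open import Data.Fin.Permutation.Transposition.List using (TranspositionList; eval; decompose; eval-decompose)
  open import Relation.Binary.Definitions using (tri<; tri≈; tri>)
  open CommutativeRing R hiding (zero)
  open import Algebra.Properties.Ring ring using (-‿involutive; -‿distribʳ-*; -‿+-comm; -0#≈0#)
  open import Algebra.Properties.Semiring.Sum semiring
    using (sum; sum-cong-≋; ∑-comm; sum-replicate-zero; *-distribˡ-sum; *-distribʳ-sum)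
  open import Algebra.Properties.CommutativeSemigroup *-commutativeSemigroup
    using () renaming (x∙yz≈y∙xz to x*[y*z]≈y*[x*z])
  open import Algebra.Properties.CommutativeSemigroup +-commutativeSemigroup
    using () renaming (x∙yz≈y∙xz to x+[y+z]≈y+[x+z])
  open FiniteSum +-commutativeMonoid using (sum-splitAt)
  open AdjacentSwap
  open Transposition
  open import Relation.Binary.Reasoning.Setoid setoid

  Matrix : ℕ → Set c
  Matrix m = Fin m → Fin m → Carrier

  _ᵀ : ∀ {m} → Matrix m → Matrix m
  (M ᵀ) i j = M j i

  reindex : ∀ {A B : Set} → (A → B) → (B → B → Carrier) → A → A → Carrier
  reindex f M i j = M (f i) (f j)

  signed : ℕ → Carrier → Carrier
  signed zero    x = x
  signed (suc k) x = - signed k x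

  minor : ∀ {m} → Matrix (suc m) → Fin (suc m) → Fin (suc m) → Matrix m
  minor M i j a b = M (punchIn i a) (punchIn j b)

  det : ∀ m → Matrix m → Carrier
  det zero    M = 1#
  det (suc m) M = sum λ j → signed (toℕ j) (M zero j * det m (minor M zero j))

  signed-cong : ∀ k {x y} → x ≈ y → signed k x ≈ signed k y
  signed-cong zero    x≈y = x≈y
  signed-cong (suc k) x≈y = -‿cong (signed-cong k x≈y)

  signed-signed : ∀ j k x → signed j (signed k x) ≡ signed (j ℕ.+ k) x
  signed-signed zero    k x = ≡.refl
  signed-signed (suc j) k x = ≡.cong -_ (signed-signed j k x)

  signed-neg : ∀ k x → signed k (- x) ≈ - signed k x
  signed-neg zero    x = refl
  signed-neg (suc k) x = -‿cong (signed-neg k x)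

  signed-*ʳ : ∀ k x y → x * signed k y ≈ signed k (x * y)
  signed-*ʳ zero    x y = refl
  signed-*ʳ (suc k) x y = trans (sym (-‿distribʳ-* x (signed k y))) (-‿cong (signed-*ʳ k x y))

  signed-*ˡ : ∀ k x y → signed k x * y ≈ signed k (x * y)
  signed-*ˡ k x y = trans (*-comm _ y) (trans (signed-*ʳ k y x) (signed-cong k (*-comm y x)))

  signed-+ : ∀ k x y → signed k (x + y) ≈ signed k x + signed k y
  signed-+ zero    x y = refl
  signed-+ (suc k) x y = trans (-‿cong (signed-+ k x y)) (sym (-‿+-comm (signed k x) (signed k y)))

  signed-0# : ∀ k → signed k 0# ≈ 0#
  signed-0# zero    = refl
  signed-0# (suc k) = trans (-‿cong (signed-0# k)) -0#≈0#

  signed-sum : ∀ k {n} (f : Vector Carrier n) → signed k (sum f) ≈ sum (signed k ∘ f)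
  signed-sum k {zero}  f = signed-0# k
  signed-sum k {suc n} f = trans (signed-+ k (f zero) (sum (f ∘ suc))) (+-congˡ (signed-sum k (f ∘ suc)))

  signed-*-sum : ∀ k x {n} (f : Vector Carrier n) → signed k (x * sum f) ≈ sum λ i → signed k (x * f i)
  signed-*-sum k x f = trans (signed-cong k (*-distribˡ-sum x f)) (signed-sum k (λ i → x * f i))

  det-cong : ∀ m {M N : Matrix m} → (∀ i j → M i j ≈ N i j) → det m M ≈ det m N
  det-cong zero    M≈N = refl
  det-cong (suc m) M≈N = sum-cong-≋ λ j →
    signed-cong (toℕ j) (*-cong (M≈N zero j) (det-cong m λ a b → M≈N (punchIn zero a) (punchIn j b)))

  signed-*-signed : ∀ a b x y → signed a (x * signed b y) ≈ signed (a ℕ.+ b) (x * y)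
  signed-*-signed a b x y = trans (signed-cong a (signed-*ʳ b x y)) (reflexive (signed-signed a b (x * y)))

  signed-*-signed-comm : ∀ a b x y z →
    signed (suc a) (x * signed b (y * z)) ≈ signed (suc b) (y * signed a (x * z))
  signed-*-signed-comm a b x y z = begin
    signed (suc a) (x * signed b (y * z))  ≈⟨ signed-*-signed (suc a) b x (y * z) ⟩
    signed (suc a ℕ.+ b) (x * (y * z))     ≡⟨ ≡.cong (λ k → signed (suc k) (x * (y * z))) (ℕₚ.+-comm a b) ⟩
    signed (suc b ℕ.+ a) (x * (y * z))     ≈⟨ signed-cong (suc b ℕ.+ a) (x*[y*z]≈y*[x*z] x y z) ⟩
    signed (suc b ℕ.+ a) (y * (x * z))     ≈⟨ signed-*-signed (suc b) a y (x * z) ⟨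
    signed (suc b) (y * signed a (x * z))  ∎

  columnExpansion : ∀ {m} → Matrix (suc m) → Carrier
  columnExpansion {m} M = sum λ i → signed (toℕ i) (M i zero * det m (minor M i zero))

  -- Expanding once more, both sides become the same double sum over the minors D i j
  -- obtained by deleting rows 0, i + 1 and columns 0, j + 1.
  det≈columnExpansion : ∀ m (M : Matrix (suc m)) → det (suc m) M ≈ columnExpansion M
  det≈columnExpansion zero    M = refl
  det≈columnExpansion (suc m) M = +-congˡ (begin
    sum (λ j → signed (suc (toℕ j)) (M zero (suc j) * det (suc m) (minor M zero (suc j))))
      ≈⟨ sum-cong-≋ (λ j → signed-cong (suc (toℕ j)) (*-congˡ {M zero (suc j)}
                             (det≈columnExpansion m (minor M zero (suc j))))) ⟩
    sum (λ j → signed (suc (toℕ j)) (M zero (suc j) * sum (columnTerms j)))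
      ≈⟨ sum-cong-≋ (λ j → signed-*-sum (suc (toℕ j)) (M zero (suc j)) (columnTerms j)) ⟩
    sum (λ j → sum λ i → rowFirst i j)
      ≈⟨ ∑-comm (λ j i → rowFirst i j) ⟩
    sum (λ i → sum λ j → rowFirst i j)
      ≈⟨ sum-cong-≋ (λ i → sum-cong-≋ λ j →
           signed-*-signed-comm (toℕ j) (toℕ i) (M zero (suc j)) (M (suc i) zero) (D i j)) ⟩
    sum (λ i → sum λ j → columnFirst i j)
      ≈⟨ sum-cong-≋ (λ i → signed-*-sum (suc (toℕ i)) (M (suc i) zero) (rowTerms i)) ⟨
    sum (λ i → signed (suc (toℕ i)) (M (suc i) zero * det (suc m) (minor M (suc i) zero))) ∎)
    where
    D : Fin (suc m) → Fin (suc m) → Carrier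
    D i j = det m λ a b → M (suc (punchIn i a)) (suc (punchIn j b))
    columnTerms rowTerms : Fin (suc m) → Fin (suc m) → Carrier
    columnTerms j i = signed (toℕ i) (M (suc i) zero * D i j)
    rowTerms    i j = signed (toℕ j) (M zero (suc j) * D i j)
    rowFirst columnFirst : Fin (suc m) → Fin (suc m) → Carrier
    rowFirst    i j = signed (suc (toℕ j)) (M zero (suc j) * columnTerms j i)
    columnFirst i j = signed (suc (toℕ i)) (M (suc i) zero * rowTerms i j)

  det-transpose : ∀ m (M : Matrix m) → det m (M ᵀ) ≈ det m M
  det-transpose zero    M = refl
  det-transpose (suc m) M = trans
    (sum-cong-≋ λ j → signed-cong (toℕ j) (*-congˡ {M j zero} (det-transpose m (minor M j zero))))
    (sym (det≈columnExpansion m M))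

  sum-adjacentSwap : ∀ {m} (c : Fin m) (f : Vector Carrier (suc m)) → sum (f ∘ adjacentSwap c) ≈ sum f
  sum-adjacentSwap {suc m} zero    f = x+[y+z]≈y+[x+z] (f (suc zero)) (f zero) (sum λ i → f (suc (suc i)))
  sum-adjacentSwap         (suc c) f = +-congˡ (sum-adjacentSwap c (f ∘ suc))

  -- In the first-row expansion the terms of the two swapped columns trade places with a
  -- sign change (their positions differ by one); every other term changes sign by induction.
  det-adjacentSwap-columns : ∀ m (c : Fin m) (M : Matrix (suc m)) →
    det (suc m) (λ i j → M i (adjacentSwap c j)) ≈ - det (suc m) M
  det-adjacentSwap-columns (suc m) c M = begin
    det (suc (suc m)) (λ i j → M i (adjacentSwap c j)) ≈⟨ sum-cong-≋ (λ j → term j (adjacentSwapView c j)) ⟩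
    sum (λ j → - f (adjacentSwap c j))                 ≈⟨ signed-sum 1 (f ∘ adjacentSwap c) ⟨
    - sum (f ∘ adjacentSwap c)                         ≈⟨ -‿cong (sum-adjacentSwap c f) ⟩
    - det (suc (suc m)) M                              ∎
    where
    f : Vector Carrier (suc (suc m))
    f j = signed (toℕ j) (M zero j * det (suc m) (minor M zero j))
    minor-swapped≈ : ∀ {j j′} → (∀ b → adjacentSwap c (punchIn j b) ≡ punchIn j′ b) →
      det (suc m) (λ a b → M (suc a) (adjacentSwap c (punchIn j b))) ≈ det (suc m) (minor M zero j′)
    minor-swapped≈ eq = det-cong (suc m) λ a b → reflexive (≡.cong (M (suc a)) (eq b))
    term : ∀ j → AdjacentSwapView c j →
      signed (toℕ j) (M zero (adjacentSwap c j) *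
                      det (suc m) (λ a b → M (suc a) (adjacentSwap c (punchIn j b))))
        ≈ - f (adjacentSwap c j)
    term _ lower rewrite adjacentSwap-inject₁ c | toℕ-inject₁ c =
      trans (signed-cong (toℕ c) (*-congˡ (minor-swapped≈ (adjacentSwap-punchIn-inject₁ c))))
            (sym (-‿involutive _))
    term _ upper rewrite adjacentSwap-suc c = -‿cong (begin
      signed (toℕ c) (M zero (inject₁ c) *
                      det (suc m) (λ a b → M (suc a) (adjacentSwap c (punchIn (suc c) b))))
        ≈⟨ signed-cong (toℕ c) (*-congˡ (minor-swapped≈ (adjacentSwap-punchIn-suc c))) ⟩
      signed (toℕ c) (M zero (inject₁ c) * det (suc m) (minor M zero (inject₁ c)))
        ≡⟨ ≡.cong (λ k → signed k (M zero (inject₁ c) * det (suc m) (minor M zero (inject₁ c))))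
                  (toℕ-inject₁ c) ⟨
      f (inject₁ c) ∎)
    term j (apart c′ fixed commutes) rewrite fixed = begin
      signed (toℕ j) (M zero j * det (suc m) (λ a b → M (suc a) (adjacentSwap c (punchIn j b))))
        ≈⟨ signed-cong (toℕ j) (*-congˡ (det-cong (suc m) λ a b →
             reflexive (≡.cong (M (suc a)) (commutes b)))) ⟩
      signed (toℕ j) (M zero j * det (suc m) (λ a b → minor M zero j a (adjacentSwap c′ b)))
        ≈⟨ signed-cong (toℕ j) (*-congˡ (det-adjacentSwap-columns m c′ (minor M zero j))) ⟩
      signed (toℕ j) (M zero j * - det (suc m) (minor M zero j))
        ≈⟨ signed-cong (toℕ j) (sym (-‿distribʳ-* _ _)) ⟩
      signed (toℕ j) (- (M zero j * det (suc m) (minor M zero j)))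
        ≈⟨ signed-neg (toℕ j) _ ⟩
      - f j ∎

  det-adjacentSwap-rows : ∀ m (c : Fin m) (M : Matrix (suc m)) →
    det (suc m) (λ i j → M (adjacentSwap c i) j) ≈ - det (suc m) M
  det-adjacentSwap-rows m c M = begin
    det (suc m) (λ i j → M (adjacentSwap c i) j)     ≈⟨ det-transpose (suc m) (λ i j → M (adjacentSwap c j) i) ⟩
    det (suc m) (λ i j → (M ᵀ) i (adjacentSwap c j)) ≈⟨ det-adjacentSwap-columns m c (M ᵀ) ⟩
    - det (suc m) (M ᵀ)                              ≈⟨ -‿cong (det-transpose (suc m) M) ⟩
    - det (suc m) M                                  ∎

  det-reindex-adjacentSwap : ∀ {m} (c : Fin m) (M : Matrix (suc m)) →
    det (suc m) (reindex (adjacentSwap c) M) ≈ det (suc m) M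
  det-reindex-adjacentSwap {m} c M = begin
    det (suc m) (reindex (adjacentSwap c) M)         ≈⟨ det-adjacentSwap-rows m c (λ i j → M i (adjacentSwap c j)) ⟩
    - det (suc m) (λ i j → M i (adjacentSwap c j))   ≈⟨ -‿cong (det-adjacentSwap-columns m c M) ⟩
    - - det (suc m) M                                ≈⟨ -‿involutive _ ⟩
    det (suc m) M                                    ∎

  -- transpose a (c + 1) is transpose a c conjugated by the adjacent swap of c and c + 1;
  -- induct on the distance d between a and c.
  det-reindex-transpose-suc : ∀ d {m} (a : Fin (suc m)) (c : Fin m) → d ℕ.+ toℕ a ≡ toℕ c →
    ∀ M → det (suc m) (reindex (transpose a (suc c)) M) ≈ det (suc m) M
  det-reindex-transpose-suc zero a c a≡c M rewrite toℕ-injective (≡.trans a≡c (≡.sym (toℕ-inject₁ c))) =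
    trans (det-cong _ λ i j → reflexive (≡.cong₂ M (transpose-adjacent c i) (transpose-adjacent c j)))
          (det-reindex-adjacentSwap c M)
  det-reindex-transpose-suc (suc d) {suc m} a (suc c) d+a≡c M = begin
    det _ (reindex (transpose a (suc (suc c))) M)
      ≈⟨ det-cong _ (λ i j → reflexive (≡.cong₂ M (conjugate i) (conjugate j))) ⟩
    det _ (reindex (adjacentSwap (suc c)) (reindex τ N))
      ≈⟨ det-reindex-adjacentSwap (suc c) (reindex τ N) ⟩
    det _ (reindex τ N)
      ≈⟨ det-reindex-transpose-suc d a (inject₁ c) (≡.trans d+a≡c′ (≡.sym (toℕ-inject₁ c))) N ⟩
    det _ N
      ≈⟨ det-reindex-adjacentSwap (suc c) M ⟩
    det _ M ∎
    where
    τ = transpose a (suc (inject₁ c))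
    N = reindex (adjacentSwap (suc c)) M
    d+a≡c′ : d ℕ.+ toℕ a ≡ toℕ c
    d+a≡c′ = ℕₚ.suc-injective d+a≡c
    conjugate = transpose-suc-conjugate {a = a} {suc c}
      (s≤s (ℕₚ.≤-trans (ℕₚ.m≤n+m (toℕ a) d) (ℕₚ.≤-reflexive d+a≡c′)))

  det-reindex-transpose< : ∀ {n} (a b : Fin n) → toℕ a < toℕ b →
    ∀ M → det n (reindex (transpose a b) M) ≈ det n M
  det-reindex-transpose< a (suc c) (s≤s a≤c) = det-reindex-transpose-suc (toℕ c ∸ toℕ a) a c (ℕₚ.m∸n+n≡m a≤c)

  det-reindex-transpose : ∀ {n} (a b : Fin n) (M : Matrix n) → det n (reindex (transpose a b) M) ≈ det n M
  det-reindex-transpose a b M with ℕₚ.<-cmp (toℕ a) (toℕ b)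
  ... | tri< a<b _ _ = det-reindex-transpose< a b a<b M
  ... | tri≈ _ a≡b _ rewrite toℕ-injective a≡b =
    det-cong _ λ i j → reflexive (≡.cong₂ M (transpose-same b i) (transpose-same b j))
  ... | tri> _ _ b<a = sym (trans
    (det-cong _ λ i j → reflexive (≡.sym (≡.cong₂ M (transpose-inverse a b {i}) (transpose-inverse a b {j}))))
    (det-reindex-transpose< b a b<a (reindex (transpose a b) M)))

  det-reindex-eval : ∀ {n} (xs : TranspositionList n) (M : Matrix n) →
    det n (reindex (eval xs ⟨$⟩ʳ_) M) ≈ det n M
  det-reindex-eval []             M = refl
  det-reindex-eval ((a , b) ∷ xs) M =
    trans (det-reindex-transpose a b (reindex (eval xs ⟨$⟩ʳ_) M)) (det-reindex-eval xs M)

  det-reindex-permutation : ∀ {m n} (π : Permutation m n) (M : Matrix n) →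
    det m (reindex (π ⟨$⟩ʳ_) M) ≈ det n M
  det-reindex-permutation π M with ↔⇒≡ π
  ... | ≡.refl = trans
    (det-cong _ λ i j → reflexive (≡.sym (≡.cong₂ M (eval-decompose π i) (eval-decompose π j))))
    (det-reindex-eval (decompose π) M)

  det-enumeration-invariant : ∀ {m n} {X : Set} (e : Fin m ↔ X) (e′ : Fin n ↔ X) (M : X → X → Carrier) →
    det m (reindex (Inverse.to e) M) ≈ det n (reindex (Inverse.to e′) M)
  det-enumeration-invariant e e′ M = trans
    (det-cong _ λ i j → reflexive (≡.sym (≡.cong₂ M (Inverse.strictlyInverseˡ e′ (Inverse.to e i))
                                                    (Inverse.strictlyInverseˡ e′ (Inverse.to e j)))))
    (det-reindex-permutation (↔-sym e′ ↔-∘ e) (reindex (Inverse.to e′) M))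

  block : ∀ {X Y : Set} → (X → X → Carrier) → (Y → Y → Carrier) → X ⊎ Y → X ⊎ Y → Carrier
  block A B (inj₁ x) (inj₁ y) = A x y
  block A B (inj₂ x) (inj₂ y) = B x y
  block A B (inj₁ _) (inj₂ _) = 0#
  block A B (inj₂ _) (inj₁ _) = 0#

  block-map : ∀ {X X′ Y Y′ : Set} (f₁ g₁ : X → X′) (f₂ g₂ : Y → Y′) A B s t →
    block A B (Sum.map f₁ f₂ s) (Sum.map g₁ g₂ t) ≡ block (λ x y → A (f₁ x) (g₁ y)) (λ x y → B (f₂ x) (g₂ y)) s t
  block-map f₁ g₁ f₂ g₂ A B (inj₁ _) (inj₁ _) = ≡.refl
  block-map f₁ g₁ f₂ g₂ A B (inj₁ _) (inj₂ _) = ≡.refl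
  block-map f₁ g₁ f₂ g₂ A B (inj₂ _) (inj₁ _) = ≡.refl
  block-map f₁ g₁ f₂ g₂ A B (inj₂ _) (inj₂ _) = ≡.refl

  blockDiagonal : ∀ {m k} → Matrix m → Matrix k → Matrix (m ℕ.+ k)
  blockDiagonal {m} A B = reindex (splitAt m) (block A B)

  det-blockDiagonal : ∀ m k (A : Matrix m) (B : Matrix k) →
    det (m ℕ.+ k) (blockDiagonal A B) ≈ det m A * det k B
  det-blockDiagonal zero    k A B = sym (*-identityˡ (det k B))
  det-blockDiagonal (suc m) k A B = begin
    det (suc m ℕ.+ k) (blockDiagonal A B)
      ≈⟨ sum-splitAt (suc m) k F ⟩
    sum (F ∘ (_↑ˡ k)) + sum (F ∘ (suc m ↑ʳ_))
      ≈⟨ +-cong (sum-cong-≋ left) (trans (sum-cong-≋ right) (sum-replicate-zero k)) ⟩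
    sum (λ j → signed (toℕ j) (A zero j * det m (minor A zero j)) * det k B) + 0#
      ≈⟨ +-identityʳ _ ⟩
    sum (λ j → signed (toℕ j) (A zero j * det m (minor A zero j)) * det k B)
      ≈⟨ *-distribʳ-sum (det k B) (λ j → signed (toℕ j) (A zero j * det m (minor A zero j))) ⟨
    det (suc m) A * det k B ∎
    where
    F : Vector Carrier (suc m ℕ.+ k)
    F j = signed (toℕ j) (blockDiagonal A B zero j * det (m ℕ.+ k) (minor (blockDiagonal A B) zero j))
    minor-blockDiagonal : ∀ j a b →
      minor (blockDiagonal A B) zero (j ↑ˡ k) a b ≡ blockDiagonal (minor A zero j) B a b
    minor-blockDiagonal j a b rewrite splitAt-punchIn-↑ˡ m k j b =
      block-map suc (punchIn j) id id A B (splitAt m a) (splitAt m b)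
    left : ∀ j → F (j ↑ˡ k) ≈ signed (toℕ j) (A zero j * det m (minor A zero j)) * det k B
    left j rewrite toℕ-↑ˡ j k | splitAt-↑ˡ (suc m) j k = begin
      signed (toℕ j) (A zero j * det (m ℕ.+ k) (minor (blockDiagonal A B) zero (j ↑ˡ k)))
        ≈⟨ signed-cong (toℕ j) (*-congˡ (det-cong (m ℕ.+ k) λ a b → reflexive (minor-blockDiagonal j a b))) ⟩
      signed (toℕ j) (A zero j * det (m ℕ.+ k) (blockDiagonal (minor A zero j) B))
        ≈⟨ signed-cong (toℕ j) (*-congˡ (det-blockDiagonal m k (minor A zero j) B)) ⟩
      signed (toℕ j) (A zero j * (det m (minor A zero j) * det k B))
        ≈⟨ signed-cong (toℕ j) (*-assoc _ _ _) ⟨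
      signed (toℕ j) (A zero j * det m (minor A zero j) * det k B)
        ≈⟨ signed-*ˡ (toℕ j) _ _ ⟨
      signed (toℕ j) (A zero j * det m (minor A zero j)) * det k B ∎
    right : ∀ i → F (suc m ↑ʳ i) ≈ 0#
    right i rewrite splitAt-↑ʳ (suc m) k i =
      trans (signed-cong (toℕ (suc m ↑ʳ i)) (zeroˡ _)) (signed-0# (toℕ (suc m ↑ʳ i)))

open import Defs

module Polynomial where

  open import Data.Integer using (0ℤ; 1ℤ; -_) renaming (_+_ to _+ℤ_; _*_ to _*ℤ_)
  import Data.Integer.Properties as ℤ
  open import Algebra.Structures.Biased using (IsCommutativeMonoidˡ)
  import Algebra.Properties.CommutativeSemigroup as CommutativeSemigroupProperties
  open import Relation.Binary.Structures using (IsEquivalence)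
  open ≡ using (refl; sym; trans; cong; cong₂)

  -- A coefficient list may end in zeros, so polynomials are compared coefficientwise.
  infix 4 _≈ₚ_
  record _≈ₚ_ (p q : Poly) : Set where
    constructor coeffwise
    field coeff-≡ : ∀ k → coeff p k ≡ coeff q k

  open _≈ₚ_ public

  ≈ₚ-isEquivalence : IsEquivalence _≈ₚ_
  ≈ₚ-isEquivalence = record
    { refl  = coeffwise λ _ → refl
    ; sym   = λ p≈q → coeffwise λ k → sym (coeff-≡ p≈q k)
    ; trans = λ p≈q q≈s → coeffwise λ k → trans (coeff-≡ p≈q k) (coeff-≡ q≈s k)
    }

  open IsEquivalence ≈ₚ-isEquivalence public
    using () renaming (refl to ≈ₚ-refl; sym to ≈ₚ-sym; trans to ≈ₚ-trans; reflexive to ≈ₚ-reflexive)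

  coeff-+ₚ : ∀ p q k → coeff (p +ₚ q) k ≡ coeff p k +ℤ coeff q k
  coeff-+ₚ []      q       k       = sym (ℤ.+-identityˡ _)
  coeff-+ₚ (a ∷ p) []      k       = sym (ℤ.+-identityʳ _)
  coeff-+ₚ (a ∷ p) (b ∷ q) zero    = refl
  coeff-+ₚ (a ∷ p) (b ∷ q) (suc k) = coeff-+ₚ p q k

  coeff-scaleₚ : ∀ c p k → coeff (scaleₚ c p) k ≡ c *ℤ coeff p k
  coeff-scaleₚ c []      k       = sym (ℤ.*-zeroʳ c)
  coeff-scaleₚ c (a ∷ p) zero    = refl
  coeff-scaleₚ c (a ∷ p) (suc k) = coeff-scaleₚ c p k

  ∷-cong : ∀ {a b p q} → a ≡ b → p ≈ₚ q → a ∷ p ≈ₚ b ∷ q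
  ∷-cong a≡b p≈q = coeffwise λ { zero → a≡b ; (suc k) → coeff-≡ p≈q k }

  +ₚ-cong : ∀ {p p′ q q′} → p ≈ₚ p′ → q ≈ₚ q′ → p +ₚ q ≈ₚ p′ +ₚ q′
  +ₚ-cong {p} {p′} {q} {q′} p≈p′ q≈q′ = coeffwise λ k →
    trans (coeff-+ₚ p q k) (trans (cong₂ _+ℤ_ (coeff-≡ p≈p′ k) (coeff-≡ q≈q′ k)) (sym (coeff-+ₚ p′ q′ k)))

  +ₚ-identityʳ : ∀ p → p +ₚ [] ≈ₚ p
  +ₚ-identityʳ []      = ≈ₚ-refl
  +ₚ-identityʳ (a ∷ p) = ≈ₚ-refl

  +ₚ-assoc : ∀ p q s → (p +ₚ q) +ₚ s ≈ₚ p +ₚ (q +ₚ s)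
  +ₚ-assoc []      q       s       = ≈ₚ-refl
  +ₚ-assoc (a ∷ p) []      s       = ≈ₚ-refl
  +ₚ-assoc (a ∷ p) (b ∷ q) []      = ≈ₚ-refl
  +ₚ-assoc (a ∷ p) (b ∷ q) (c ∷ s) = ∷-cong (ℤ.+-assoc a b c) (+ₚ-assoc p q s)

  +ₚ-comm : ∀ p q → p +ₚ q ≈ₚ q +ₚ p
  +ₚ-comm []      q       = ≈ₚ-sym (+ₚ-identityʳ q)
  +ₚ-comm (a ∷ p) []      = ≈ₚ-refl
  +ₚ-comm (a ∷ p) (b ∷ q) = ∷-cong (ℤ.+-comm a b) (+ₚ-comm p q)

  +ₚ-commutativeMonoid : CommutativeMonoid _ _
  +ₚ-commutativeMonoid = record
    { isCommutativeMonoid = IsCommutativeMonoidˡ.isCommutativeMonoid (record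
      { isSemigroup = record
        { isMagma = record { isEquivalence = ≈ₚ-isEquivalence ; ∙-cong = +ₚ-cong }
        ; assoc   = +ₚ-assoc }
      ; identityˡ = λ _ → ≈ₚ-refl
      ; comm      = +ₚ-comm }) }

  open CommutativeSemigroupProperties (CommutativeMonoid.commutativeSemigroup +ₚ-commutativeMonoid)
    using (interchange; x∙yz≈y∙xz)

  scaleₚ-cong : ∀ c {p q} → p ≈ₚ q → scaleₚ c p ≈ₚ scaleₚ c q
  scaleₚ-cong c {p} {q} p≈q = coeffwise λ k →
    trans (coeff-scaleₚ c p k) (trans (cong (c *ℤ_) (coeff-≡ p≈q k)) (sym (coeff-scaleₚ c q k)))

  scaleₚ-distrib-+ₚ : ∀ c p q → scaleₚ c (p +ₚ q) ≈ₚ scaleₚ c p +ₚ scaleₚ c q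
  scaleₚ-distrib-+ₚ c []      q       = ≈ₚ-refl
  scaleₚ-distrib-+ₚ c (a ∷ p) []      = ≈ₚ-refl
  scaleₚ-distrib-+ₚ c (a ∷ p) (b ∷ q) = ∷-cong (ℤ.*-distribˡ-+ c a b) (scaleₚ-distrib-+ₚ c p q)

  scaleₚ-scaleₚ : ∀ a b p → scaleₚ a (scaleₚ b p) ≈ₚ scaleₚ (a *ℤ b) p
  scaleₚ-scaleₚ a b []      = ≈ₚ-refl
  scaleₚ-scaleₚ a b (c ∷ p) = ∷-cong (sym (ℤ.*-assoc a b c)) (scaleₚ-scaleₚ a b p)

  scaleₚ-zero : ∀ p → scaleₚ 0ℤ p ≈ₚ []
  scaleₚ-zero p = coeffwise (coeff-scaleₚ 0ℤ p)

  scaleₚ-one : ∀ p → scaleₚ 1ℤ p ≈ₚ p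
  scaleₚ-one []      = ≈ₚ-refl
  scaleₚ-one (a ∷ p) = ∷-cong (ℤ.*-identityˡ a) (scaleₚ-one p)

  negₚ-inverseˡ : ∀ p → negₚ p +ₚ p ≈ₚ []
  negₚ-inverseˡ p = coeffwise λ k →
    trans (coeff-+ₚ (negₚ p) p k)
          (trans (cong (_+ℤ coeff p k) (trans (coeff-scaleₚ (- 1ℤ) p k) (ℤ.-1*i≡-i (coeff p k))))
                 (ℤ.+-inverseˡ (coeff p k)))

  *ₚ-zeroʳ : ∀ p → p *ₚ [] ≈ₚ []
  *ₚ-zeroʳ []      = ≈ₚ-refl
  *ₚ-zeroʳ (a ∷ p) = coeffwise λ { zero → refl ; (suc k) → coeff-≡ (*ₚ-zeroʳ p) k }

  *ₚ-∷ʳ : ∀ p b q → p *ₚ (b ∷ q) ≈ₚ scaleₚ b p +ₚ (0ℤ ∷ p *ₚ q)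
  *ₚ-∷ʳ []      b q = coeffwise λ { zero → refl ; (suc k) → refl }
  *ₚ-∷ʳ (a ∷ p) b q = ∷-cong (cong (_+ℤ 0ℤ) (ℤ.*-comm a b))
    (≈ₚ-trans (+ₚ-cong (≈ₚ-refl {scaleₚ a q}) (*ₚ-∷ʳ p b q)) (x∙yz≈y∙xz (scaleₚ a q) (scaleₚ b p) _))

  *ₚ-comm : ∀ p q → p *ₚ q ≈ₚ q *ₚ p
  *ₚ-comm []      q = ≈ₚ-sym (*ₚ-zeroʳ q)
  *ₚ-comm (a ∷ p) q =
    ≈ₚ-trans (+ₚ-cong (≈ₚ-refl {scaleₚ a q}) (∷-cong refl (*ₚ-comm p q))) (≈ₚ-sym (*ₚ-∷ʳ q a p))

  *ₚ-congˡ : ∀ p {q q′} → q ≈ₚ q′ → p *ₚ q ≈ₚ p *ₚ q′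
  *ₚ-congˡ []      q≈q′ = ≈ₚ-refl
  *ₚ-congˡ (a ∷ p) q≈q′ = +ₚ-cong (scaleₚ-cong a q≈q′) (∷-cong refl (*ₚ-congˡ p q≈q′))

  *ₚ-cong : ∀ {p p′ q q′} → p ≈ₚ p′ → q ≈ₚ q′ → p *ₚ q ≈ₚ p′ *ₚ q′
  *ₚ-cong {p} {p′} {q} {q′} p≈p′ q≈q′ = ≈ₚ-trans (*ₚ-congˡ p q≈q′)
    (≈ₚ-trans (*ₚ-comm p q′) (≈ₚ-trans (*ₚ-congˡ q′ p≈p′) (*ₚ-comm q′ p′)))

  *ₚ-distribˡ-+ₚ : ∀ p q s → p *ₚ (q +ₚ s) ≈ₚ (p *ₚ q) +ₚ (p *ₚ s)
  *ₚ-distribˡ-+ₚ []      q s = ≈ₚ-refl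
  *ₚ-distribˡ-+ₚ (a ∷ p) q s = ≈ₚ-trans
    (+ₚ-cong (scaleₚ-distrib-+ₚ a q s) (∷-cong refl (*ₚ-distribˡ-+ₚ p q s)))
    (interchange (scaleₚ a q) (scaleₚ a s) (0ℤ ∷ p *ₚ q) (0ℤ ∷ p *ₚ s))

  *ₚ-distribʳ-+ₚ : ∀ p q s → (q +ₚ s) *ₚ p ≈ₚ (q *ₚ p) +ₚ (s *ₚ p)
  *ₚ-distribʳ-+ₚ p q s = ≈ₚ-trans (*ₚ-comm (q +ₚ s) p)
    (≈ₚ-trans (*ₚ-distribˡ-+ₚ p q s) (+ₚ-cong (*ₚ-comm p q) (*ₚ-comm p s)))

  scaleₚ-*ₚ : ∀ a p q → scaleₚ a p *ₚ q ≈ₚ scaleₚ a (p *ₚ q)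
  scaleₚ-*ₚ a []      q = ≈ₚ-refl
  scaleₚ-*ₚ a (b ∷ p) q = ≈ₚ-trans
    (+ₚ-cong (≈ₚ-sym (scaleₚ-scaleₚ a b q)) (∷-cong (sym (ℤ.*-zeroʳ a)) (scaleₚ-*ₚ a p q)))
    (≈ₚ-sym (scaleₚ-distrib-+ₚ a (scaleₚ b q) (0ℤ ∷ p *ₚ q)))

  0∷-*ₚ : ∀ p q → (0ℤ ∷ p) *ₚ q ≈ₚ 0ℤ ∷ p *ₚ q
  0∷-*ₚ p q = +ₚ-cong (scaleₚ-zero q) ≈ₚ-refl

  *ₚ-assoc : ∀ p q s → (p *ₚ q) *ₚ s ≈ₚ p *ₚ (q *ₚ s)
  *ₚ-assoc []      q s = ≈ₚ-refl
  *ₚ-assoc (a ∷ p) q s = ≈ₚ-trans (*ₚ-distribʳ-+ₚ s (scaleₚ a q) (0ℤ ∷ p *ₚ q))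
    (+ₚ-cong (scaleₚ-*ₚ a q s) (≈ₚ-trans (0∷-*ₚ (p *ₚ q) s) (∷-cong refl (*ₚ-assoc p q s))))

  *ₚ-identityˡ : ∀ p → (1ℤ ∷ []) *ₚ p ≈ₚ p
  *ₚ-identityˡ p = ≈ₚ-trans (+ₚ-cong (scaleₚ-one p) (coeffwise λ { zero → refl ; (suc k) → refl }))
                            (+ₚ-identityʳ p)

  polyRing : CommutativeRing _ _
  polyRing = record
    { Carrier = Poly ; _≈_ = _≈ₚ_ ; _+_ = _+ₚ_ ; _*_ = _*ₚ_ ; -_ = negₚ ; 0# = [] ; 1# = 1ℤ ∷ []
    ; isCommutativeRing = record
      { isRing = record
        { +-isAbelianGroup = record
          { isGroup = record
            { isMonoid = CommutativeMonoid.isMonoid +ₚ-commutativeMonoid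
            ; inverse  = negₚ-inverseˡ , λ p → ≈ₚ-trans (+ₚ-comm p (negₚ p)) (negₚ-inverseˡ p)
            ; ⁻¹-cong  = scaleₚ-cong (- 1ℤ) }
          ; comm = +ₚ-comm }
        ; *-cong     = *ₚ-cong
        ; *-assoc    = *ₚ-assoc
        ; *-identity = *ₚ-identityˡ , λ p → ≈ₚ-trans (*ₚ-comm p _) (*ₚ-identityˡ p)
        ; distrib    = *ₚ-distribˡ-+ₚ , *ₚ-distribʳ-+ₚ }
      ; *-comm = *ₚ-comm } }

module SignlessLaplacian where

  open import Data.Nat using (_+_)
  open import Data.Fin.Properties using (+↔⊎; join-splitAt)
  open import Data.Integer using (ℤ; 0ℤ; 1ℤ; -_) renaming (_+_ to _+ℤ_)
  import Data.Integer.Properties as ℤ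
  open import Data.Bool using (Bool; false; if_then_else_)
  open import Data.Sum using ([_,_]′)
  open import Data.Sum.Function.Propositional using (_⊎-↔_)
  open import Data.Sum.Properties using (inj₁-injective; inj₂-injective)
  open import Function using (mk↔ₛ′; Injection)
  open import Function.Properties.Inverse using (↔⇒↣)
  open import Relation.Nullary.Decidable using (⌊_⌋)
  import Algebra.Properties.CommutativeMonoid.Sum as CommutativeMonoidSum
  open ≡ using (refl)
  open Polynomial

  module Det = Determinant polyRing
  module PolySum = CommutativeMonoidSum (CommutativeRing.+-commutativeMonoid polyRing)
  module ℤSum = CommutativeMonoidSum ℤ.+-0-commutativeMonoid
  open FiniteSum ℤ.+-0-commutativeMonoid using (sum-splitAt; sum-enumeration-invariant)
  open Inverse using (to)

  sumₚ≡sum : ∀ k (f : Fin k → Poly) → sumₚ k f ≡ PolySum.sum f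
  sumₚ≡sum zero    f = refl
  sumₚ≡sum (suc k) f = ≡.cong (f zero +ₚ_) (sumₚ≡sum k (f ∘ suc))

  altₚ≡signed : ∀ k p → altₚ k p ≡ Det.signed k p
  altₚ≡signed zero    p = refl
  altₚ≡signed (suc k) p = ≡.cong negₚ (altₚ≡signed k p)

  det≈Det-det : ∀ m (M : Fin m → Fin m → Poly) → det m M ≈ₚ Det.det m M
  det≈Det-det zero    M = ≈ₚ-refl
  det≈Det-det (suc m) M = ≈ₚ-trans (≈ₚ-reflexive (sumₚ≡sum (suc m) λ j → altₚ (toℕ j) (term j)))
    (PolySum.sum-cong-≋ λ j → ≈ₚ-trans (≈ₚ-reflexive (altₚ≡signed (toℕ j) (term j)))
      (Det.signed-cong (toℕ j) (*ₚ-congˡ (M zero j) (det≈Det-det m (Det.minor M zero j)))))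
    where
    term : Fin (suc m) → Poly
    term j = M zero j *ₚ det m (Det.minor M zero j)

  sumℤ≡sum : ∀ k (f : Fin k → ℤ) → sumℤ k f ≡ ℤSum.sum f
  sumℤ≡sum zero    f = refl
  sumℤ≡sum (suc k) f = ≡.cong (f zero +ℤ_) (sumℤ≡sum k (f ∘ suc))

  -- The entries of tI − Q(A), written so that charPolyQ A unfolds to their determinant.
  charEntry : Bool → ℤ → Bool → Poly
  charEntry same d adjacent =
    (if same then 0ℤ ∷ 1ℤ ∷ [] else []) +ₚ ((- ((if same then d else 0ℤ) +ℤ b2z adjacent)) ∷ [])

  charMatrix : ∀ {n} → Adj n → V n → V n → Poly
  charMatrix A x y = charEntry ⌊ x ≟V y ⌋ (degree A x) (A x y)

  vertexEnumeration : ∀ n → Fin (n + n) ↔ V n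
  vertexEnumeration n = +↔⊎

  charPolyQ≈Det-det : ∀ {n} (A : Adj n) →
    charPolyQ A ≈ₚ Det.det (n + n) (Det.reindex (to (vertexEnumeration n)) (charMatrix A))
  charPolyQ≈Det-det {n} A = det≈Det-det (n + n) _

  degree≡sum : ∀ {n} (A : Adj n) x → degree A x ≡ ℤSum.sum (b2z ∘ A x ∘ to (vertexEnumeration n))
  degree≡sum {n} A x = sumℤ≡sum (n + n) _

  ⌊≟V⌋-injective : ∀ {m n} (φ : V m → V n) → (∀ {x y} → φ x ≡ φ y → x ≡ y) →
    ∀ x y → ⌊ φ x ≟V φ y ⌋ ≡ ⌊ x ≟V y ⌋
  ⌊≟V⌋-injective φ φ-injective x y with x ≟V y | φ x ≟V φ y
  ... | yes _   | yes _     = refl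
  ... | no _    | no _      = refl
  ... | yes x≡y | no φx≢φy  = ⊥-elim (φx≢φy (≡.cong φ x≡y))
  ... | no x≢y  | yes φx≡φy = ⊥-elim (x≢y (φ-injective φx≡φy))

  charMatrix-relabel : ∀ {m n} {A : Adj m} {B : Adj n} (φ : V m → V n) → (∀ {x y} → φ x ≡ φ y → x ≡ y) →
    (∀ x → degree B (φ x) ≡ degree A x) → (∀ x y → B (φ x) (φ y) ≡ A x y) →
    ∀ x y → charMatrix B (φ x) (φ y) ≡ charMatrix A x y
  charMatrix-relabel {B = B} φ φ-injective deg adj x y = ≡.trans
    (≡.cong₂ (λ same d → charEntry same d (B (φ x) (φ y))) (⌊≟V⌋-injective φ φ-injective x y) (deg x))
    (≡.cong (charEntry ⌊ x ≟V y ⌋ _) (adj x y))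

  charMatrix-nonadjacent : ∀ {n} (A : Adj n) {x y} → x ≢ y → A x y ≡ false → charMatrix A x y ≈ₚ []
  charMatrix-nonadjacent A {x} {y} x≢y nonadjacent with x ≟V y
  ... | yes x≡y = ⊥-elim (x≢y x≡y)
  ... | no _    rewrite nonadjacent = coeffwise λ { zero → refl ; (suc k) → refl }

  degree-Isomorphic : ∀ {n} {A B : Adj n} (σ : V n ↔ V n) →
    (∀ x y → B (to σ x) (to σ y) ≡ A x y) → ∀ x → degree B (to σ x) ≡ degree A x
  degree-Isomorphic {n} {A} {B} σ adj x = begin
    degree B (to σ x)                        ≡⟨ degree≡sum B (to σ x) ⟩
    ℤSum.sum (b2z ∘ B (to σ x) ∘ to e)        ≡⟨ sum-enumeration-invariant e (σ ↔-∘ e) (b2z ∘ B (to σ x)) ⟩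
    ℤSum.sum (b2z ∘ B (to σ x) ∘ to σ ∘ to e) ≡⟨ ℤSum.sum-cong-≗ (λ i → ≡.cong b2z (adj x (to e i))) ⟩
    ℤSum.sum (b2z ∘ A x ∘ to e)               ≡⟨ degree≡sum A x ⟨
    degree A x                               ∎
    where
    open ≡.≡-Reasoning
    e = vertexEnumeration n

  charPolyQ-Isomorphic : ∀ {n} {A B : Adj n} → Isomorphic A B → charPolyQ A ≈ₚ charPolyQ B
  charPolyQ-Isomorphic {n} {A} {B} (σ , adj) = begin
    charPolyQ A
      ≈⟨ charPolyQ≈Det-det A ⟩
    Det.det (n + n) (Det.reindex (to e) (charMatrix A))
      ≈⟨ Det.det-cong (n + n) (λ i j → ≈ₚ-reflexive (≡.sym (relabel (to e i) (to e j)))) ⟩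
    Det.det (n + n) (Det.reindex (to (σ ↔-∘ e)) (charMatrix B))
      ≈⟨ Det.det-enumeration-invariant (σ ↔-∘ e) e (charMatrix B) ⟩
    Det.det (n + n) (Det.reindex (to e) (charMatrix B))
      ≈⟨ charPolyQ≈Det-det B ⟨
    charPolyQ B ∎
    where
    open import Relation.Binary.Reasoning.Setoid (CommutativeRing.setoid polyRing)
    e = vertexEnumeration n
    relabel = charMatrix-relabel {A = A} {B} (to σ) (Injection.injective (↔⇒↣ σ))
                                 (degree-Isomorphic {A = A} {B} σ adj) adj

  unionVertex : ∀ {q r} → V q ⊎ V r → V (q + r)
  unionVertex {q} {r} (inj₁ (inj₁ a)) = inj₁ (a ↑ˡ r)
  unionVertex {q} {r} (inj₁ (inj₂ a)) = inj₂ (a ↑ˡ r)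
  unionVertex {q} {r} (inj₂ (inj₁ b)) = inj₁ (q ↑ʳ b)
  unionVertex {q} {r} (inj₂ (inj₂ b)) = inj₂ (q ↑ʳ b)

  splitV-unionVertex : ∀ {q r} (u : V q ⊎ V r) → splitV q r (unionVertex u) ≡ u
  splitV-unionVertex {q} {r} (inj₁ (inj₁ a)) rewrite splitAt-↑ˡ q a r = refl
  splitV-unionVertex {q} {r} (inj₁ (inj₂ a)) rewrite splitAt-↑ˡ q a r = refl
  splitV-unionVertex {q} {r} (inj₂ (inj₁ b)) rewrite splitAt-↑ʳ q r b = refl
  splitV-unionVertex {q} {r} (inj₂ (inj₂ b)) rewrite splitAt-↑ʳ q r b = refl

  unionVertex-splitV : ∀ q r (x : V (q + r)) → unionVertex (splitV q r x) ≡ x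
  unionVertex-splitV q r (inj₁ i) with splitAt q i | join-splitAt q r i
  ... | inj₁ _ | a↑ˡr≡i = ≡.cong inj₁ a↑ˡr≡i
  ... | inj₂ _ | q↑ʳb≡i = ≡.cong inj₁ q↑ʳb≡i
  unionVertex-splitV q r (inj₂ i) with splitAt q i | join-splitAt q r i
  ... | inj₁ _ | a↑ˡr≡i = ≡.cong inj₂ a↑ˡr≡i
  ... | inj₂ _ | q↑ʳb≡i = ≡.cong inj₂ q↑ʳb≡i

  unionVertices : ∀ q r → (V q ⊎ V r) ↔ V (q + r)
  unionVertices q r = mk↔ₛ′ unionVertex (splitV q r) (unionVertex-splitV q r) splitV-unionVertex

  unionVertex-injective : ∀ {q r} {u w : V q ⊎ V r} → unionVertex u ≡ unionVertex w → u ≡ w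
  unionVertex-injective {q} {r} = Injection.injective (↔⇒↣ (unionVertices q r))

  unionEnumeration : ∀ q r → Fin ((q + q) + (r + r)) ↔ (V q ⊎ V r)
  unionEnumeration q r = (vertexEnumeration q ⊎-↔ vertexEnumeration r) ↔-∘ +↔⊎

  sum-unionEnumeration : ∀ q r (f : V q ⊎ V r → ℤ) →
    ℤSum.sum (f ∘ to (unionEnumeration q r))
      ≡ ℤSum.sum (f ∘ inj₁ ∘ to (vertexEnumeration q)) +ℤ ℤSum.sum (f ∘ inj₂ ∘ to (vertexEnumeration r))
  sum-unionEnumeration q r f = ≡.trans (sum-splitAt (q + q) (r + r) _) (≡.cong₂ _+ℤ_
    (ℤSum.sum-cong-≗ λ i → ≡.cong (f ∘ Sum.map (splitAt q) (splitAt r)) (splitAt-↑ˡ (q + q) i (r + r)))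
    (ℤSum.sum-cong-≗ λ i → ≡.cong (f ∘ Sum.map (splitAt q) (splitAt r)) (splitAt-↑ʳ (q + q) (r + r) i)))

  module DisjointUnion {q r} (G : Adj q) (G' : Adj r) where

    G₁ : Adj (q + r)
    G₁ = disjointUnion G G'

    adjacency-unionVertex : ∀ u w → G₁ (unionVertex u) (unionVertex w) ≡ unionAdj' G G' u w
    adjacency-unionVertex u w = ≡.cong₂ (unionAdj' G G') (splitV-unionVertex u) (splitV-unionVertex w)

    degree-unionVertex : ∀ u → degree G₁ (unionVertex u) ≡ [ degree G , degree G' ]′ u
    degree-unionVertex u = begin
      degree G₁ (unionVertex u)
        ≡⟨ degree≡sum G₁ (unionVertex u) ⟩
      ℤSum.sum (b2z ∘ G₁ (unionVertex u) ∘ to (vertexEnumeration (q + r)))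
        ≡⟨ sum-enumeration-invariant (vertexEnumeration (q + r)) (unionVertices q r ↔-∘ unionEnumeration q r)
                                     (b2z ∘ G₁ (unionVertex u)) ⟩
      ℤSum.sum (b2z ∘ G₁ (unionVertex u) ∘ unionVertex ∘ to (unionEnumeration q r))
        ≡⟨ ℤSum.sum-cong-≗ (λ i → ≡.cong b2z (adjacency-unionVertex u (to (unionEnumeration q r) i))) ⟩
      ℤSum.sum (b2z ∘ unionAdj' G G' u ∘ to (unionEnumeration q r))
        ≡⟨ sum-unionEnumeration q r (b2z ∘ unionAdj' G G' u) ⟩
      componentSums u
        ≡⟨ componentSums≡degree u ⟩
      [ degree G , degree G' ]′ u ∎
      where
      open ≡.≡-Reasoning
      componentSums : V q ⊎ V r → ℤ
      componentSums u = ℤSum.sum (b2z ∘ unionAdj' G G' u ∘ inj₁ ∘ to (vertexEnumeration q))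
                     +ℤ ℤSum.sum (b2z ∘ unionAdj' G G' u ∘ inj₂ ∘ to (vertexEnumeration r))
      componentSums≡degree : ∀ u → componentSums u ≡ [ degree G , degree G' ]′ u
      componentSums≡degree (inj₁ x) =
        ≡.trans (≡.cong₂ _+ℤ_ (≡.sym (degree≡sum G x)) (ℤSum.sum-replicate-zero (r + r))) (ℤ.+-identityʳ _)
      componentSums≡degree (inj₂ y) =
        ≡.trans (≡.cong₂ _+ℤ_ (ℤSum.sum-replicate-zero (q + q)) (≡.sym (degree≡sum G' y))) (ℤ.+-identityˡ _)

    charMatrix-unionVertex : ∀ u w →
      charMatrix G₁ (unionVertex u) (unionVertex w) ≈ₚ Det.block (charMatrix G) (charMatrix G') u w
    charMatrix-unionVertex (inj₁ x) (inj₁ y) = ≈ₚ-reflexive (charMatrix-relabel {A = G} {G₁} (unionVertex ∘ inj₁)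
      (inj₁-injective ∘ unionVertex-injective) (degree-unionVertex ∘ inj₁)
      (λ x y → adjacency-unionVertex (inj₁ x) (inj₁ y)) x y)
    charMatrix-unionVertex (inj₂ x) (inj₂ y) = ≈ₚ-reflexive (charMatrix-relabel {A = G'} {G₁} (unionVertex ∘ inj₂)
      (inj₂-injective ∘ unionVertex-injective) (degree-unionVertex ∘ inj₂)
      (λ x y → adjacency-unionVertex (inj₂ x) (inj₂ y)) x y)
    charMatrix-unionVertex (inj₁ x) (inj₂ y) =
      charMatrix-nonadjacent G₁ ((λ ()) ∘ unionVertex-injective) (adjacency-unionVertex (inj₁ x) (inj₂ y))
    charMatrix-unionVertex (inj₂ x) (inj₁ y) =
      charMatrix-nonadjacent G₁ ((λ ()) ∘ unionVertex-injective) (adjacency-unionVertex (inj₂ x) (inj₁ y))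

    charPolyQ-disjointUnion : charPolyQ G₁ ≈ₚ charPolyQ G *ₚ charPolyQ G'
    charPolyQ-disjointUnion = begin
      charPolyQ G₁
        ≈⟨ charPolyQ≈Det-det G₁ ⟩
      Det.det _ (Det.reindex (to (vertexEnumeration (q + r))) (charMatrix G₁))
        ≈⟨ Det.det-enumeration-invariant (vertexEnumeration (q + r)) (unionVertices q r ↔-∘ U) (charMatrix G₁) ⟩
      Det.det _ (Det.reindex (unionVertex ∘ to U) (charMatrix G₁))
        ≈⟨ Det.det-cong _ (λ i j → charMatrix-unionVertex (to U i) (to U j)) ⟩
      Det.det _ (Det.reindex (to U) (Det.block (charMatrix G) (charMatrix G')))
        ≈⟨ Det.det-cong _ (λ i j → ≈ₚ-reflexive (Det.block-map (to eq) (to eq) (to er) (to er)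
             (charMatrix G) (charMatrix G') (splitAt (q + q) i) (splitAt (q + q) j))) ⟩
      Det.det _ (Det.blockDiagonal (Det.reindex (to eq) (charMatrix G)) (Det.reindex (to er) (charMatrix G')))
        ≈⟨ Det.det-blockDiagonal (q + q) (r + r) _ _ ⟩
      Det.det _ (Det.reindex (to eq) (charMatrix G)) *ₚ Det.det _ (Det.reindex (to er) (charMatrix G'))
        ≈⟨ *ₚ-cong (≈ₚ-sym (charPolyQ≈Det-det G)) (≈ₚ-sym (charPolyQ≈Det-det G')) ⟩
      charPolyQ G *ₚ charPolyQ G' ∎
      where
      open import Relation.Binary.Reasoning.Setoid (CommutativeRing.setoid polyRing)
      U = unionEnumeration q r
      eq = vertexEnumeration q
      er = vertexEnumeration r

    partialTranspose-disjointUnion : ∀ x y →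
      partialTranspose G₁ x y ≡ disjointUnion (partialTranspose G) (partialTranspose G') x y
    partialTranspose-disjointUnion (inj₁ a) (inj₁ b) with splitAt q a | splitAt q b
    ... | inj₁ _ | inj₁ _ = refl
    ... | inj₁ _ | inj₂ _ = refl
    ... | inj₂ _ | inj₁ _ = refl
    ... | inj₂ _ | inj₂ _ = refl
    partialTranspose-disjointUnion (inj₁ a) (inj₂ b) with splitAt q a | splitAt q b
    ... | inj₁ _ | inj₁ _ = refl
    ... | inj₁ _ | inj₂ _ = refl
    ... | inj₂ _ | inj₁ _ = refl
    ... | inj₂ _ | inj₂ _ = refl
    partialTranspose-disjointUnion (inj₂ a) (inj₁ b) with splitAt q a | splitAt q b
    ... | inj₁ _ | inj₁ _ = refl
    ... | inj₁ _ | inj₂ _ = refl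
    ... | inj₂ _ | inj₁ _ = refl
    ... | inj₂ _ | inj₂ _ = refl
    partialTranspose-disjointUnion (inj₂ a) (inj₂ b) with splitAt q a | splitAt q b
    ... | inj₁ _ | inj₁ _ = refl
    ... | inj₁ _ | inj₂ _ = refl
    ... | inj₂ _ | inj₁ _ = refl
    ... | inj₂ _ | inj₂ _ = refl

  open DisjointUnion public using (charPolyQ-disjointUnion; partialTranspose-disjointUnion)

open Polynomial using (coeffwise; coeff-≡; *ₚ-cong; polyRing)
open SignlessLaplacian using (charPolyQ-Isomorphic; charPolyQ-disjointUnion; partialTranspose-disjointUnion)
open import Function.Construct.Identity using (↔-id)

mainTheorem5 : (q r : ℕ) (G : Adj q) (G' : Adj r) →
    IsSimple G → IsSimple G' →
    QCospectral G (partialTranspose G) →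
    Isomorphic G' (partialTranspose G') →
    QCospectral (disjointUnion G G') (partialTranspose (disjointUnion G G'))
mainTheorem5 q r G G' _ _ G-cospectral G'-isomorphic = coeff-≡ (begin
  charPolyQ (disjointUnion G G')
    ≈⟨ charPolyQ-disjointUnion G G' ⟩
  charPolyQ G *ₚ charPolyQ G'
    ≈⟨ *ₚ-cong {charPolyQ G} {charPolyQ (partialTranspose G)} (coeffwise G-cospectral)
               (charPolyQ-Isomorphic {B = partialTranspose G'} G'-isomorphic) ⟩
  charPolyQ (partialTranspose G) *ₚ charPolyQ (partialTranspose G')
    ≈⟨ charPolyQ-disjointUnion (partialTranspose G) (partialTranspose G') ⟨
  charPolyQ (disjointUnion (partialTranspose G) (partialTranspose G'))
    ≈⟨ charPolyQ-Isomorphic {B = partialTranspose (disjointUnion G G')}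
                            (↔-id _ , partialTranspose-disjointUnion G G') ⟩
  charPolyQ (partialTranspose (disjointUnion G G')) ∎)
  where open import Relation.Binary.Reasoning.Setoid (CommutativeRing.setoid polyRing)
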